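{- The triple $\langle F,U,\phi\rangle$ is an adjunction from $\mathbf{K}_R$ to $\mathbf{K}_{\mathrm{alg}}$; that is, for all $\mathbf{X}\in\mathcal{K}_R$ and $\mathbf{A}\in\mathcal{K}_{\mathrm{alg}}$, the map $\phi_{\mathbf{X},\mathbf{A}}:\mathbf{K}_{\mathrm{alg}}(F\mathbf{X},\mathbf{A})\to\mathbf{K}_R(\mathbf{X},U\mathbf{A})$, $\phi_{\mathbf{X},\mathbf{A}}(f)=Uf\circ\eta_{\mathbf{X}}$, is a bijection, natural in $\mathbf{X}$ and $\mathbf{A}$.
   Context: Setting: $L$ is a first-order language with set of function symbols $L_{\mathrm{alg}}$ and an $n$-ary relation symbol $R$; $\mathcal{K}$ is a class of $L$-structures and there are $L$-terms $t_1,\dots,t_m,s_1,\dots,s_m$ in $x_1,\dots,x_n$ with $\mathcal{K}\models\forall\bar x\,(R(\bar x)\iff\bigwedge_{i=1}^m t_i(\bar x)=s_i(\bar x))$. $\mathcal{K}_{\mathrm{alg}}$, $\mathcal{K}_R$ are the classes of reducts of members of $\mathcal{K}$ to $L_{\mathrm{alg}}$ and to $\{R\}$, with categories $\mathbf{K}_{\mathrm{alg}}$, $\mathbf{K}_R$ of homomorphisms (for $\mathbf{K}_R$: $R$-preserving maps); $\mathcal{K}_{\mathrm{alg}}$ is assumed to be a variety. $U:\mathbf{K}_{\mathrm{alg}}\to\mathbf{K}_R$ sends $\mathbf{A}$ to $(A,R^{\mathbf{A}})$ with $\bar a\in R^{\mathbf{A}}$ iff $\mathbf{A}\models\bigwedge_i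 t_i(\bar a)=s_i(\bar a)$, and morphisms to the same maps. For a set $X$, $\mathbf{F}_{\mathcal{K}}(X)=T(X)/\delta_X$ is the free $\mathcal{K}_{\mathrm{alg}}$-algebra over $X$ ($T(X)$ the term algebra, $\delta_X$ the least congruence with quotient in $\mathcal{K}_{\mathrm{alg}}$, $[t]$ the class of $t$). For $\mathbf{X}\in\mathcal{K}_R$, $\theta_{\mathbf{X}}$ is the congruence of $\mathbf{F}_{\mathcal{K}}(X)$ generated by the pairs $\langle[t_i(\bar x)],[s_i(\bar x)]\rangle$ for $1\le i\le m$ and $\bar x\in R^{\mathbf{X}}$; $F\mathbf{X}=\mathbf{F}_{\mathcal{K}}(X)/\theta_{\mathbf{X}}$; for a $\mathbf{K}_R$-morphism $f:\mathbf{X}\to\mathbf{Y}$, $Ff([t(\bar x)]/\theta_{\mathbf{X}})=[t(f(\bar x))]/\theta_{\mathbf{Y}}$. $\eta_{\mathbf{X}}:\mathbf{X}\to UF\mathbf{X}$ is $\eta_{\mathbf{X}}(a)=[a]/\theta_{\mathbf{X}}$. -}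

module Defs where

-- Setting of Theorem 3.12.
-- Carriers are setoids (Agda has no quotient types); classical sets are
-- the special case of propositional equality.  Everything lives in Set₀.

open import Level using (0ℓ)
open import Data.Nat using (ℕ)
open import Data.Fin using (Fin)
open import Data.Product using (Σ; _×_; _,_; proj₁; proj₂)
open import Function using (_∘_)
open import Function.Definitions using (Bijective)
open import Relation.Binary.Bundles using (Setoid)

record Signature : Set₁ where
  field
    Op    : Set
    arity : Op → ℕ

module Algebraic (𝑆 : Signature) where
  open Signature 𝑆

  data Term (X : Set) : Set where
    var : X → Term X
    op  : (o : Op) → (Fin (arity o) → Term X) → Term X

  _[_] : ∀ {X Y : Set} → Term X → (X → Term Y) → Term Y
  var x   [ σ ] = σ x
  op o ts [ σ ] = op o (λ i → ts i [ σ ])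

  record Ops (S : Setoid 0ℓ 0ℓ) : Set where
    open Setoid S
    field
      ⟦_⟧     : (o : Op) → (Fin (arity o) → Carrier) → Carrier
      ⟦⟧-cong : ∀ o {xs ys} → (∀ i → xs i ≈ ys i) → ⟦ o ⟧ xs ≈ ⟦ o ⟧ ys

  record Algebra : Set₁ where
    field
      setoid : Setoid 0ℓ 0ℓ
      ops    : Ops setoid
    open Setoid setoid public
    open Ops ops public

  open Algebra using (Carrier)

  eval : ∀ {X : Set} (A : Algebra) → (X → Carrier A) → Term X → Carrier A
  eval A ρ (var x)   = ρ x
  eval A ρ (op o ts) = Algebra.⟦_⟧ A o (λ i → eval A ρ (ts i))

  eval-cong : ∀ {X : Set} (A : Algebra) {ρ ρ' : X → Carrier A} →
              (∀ x → Algebra._≈_ A (ρ x) (ρ' x)) →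
              ∀ u → Algebra._≈_ A (eval A ρ u) (eval A ρ' u)
  eval-cong A p (var x)   = p x
  eval-cong A p (op o ts) = Algebra.⟦⟧-cong A o (λ i → eval-cong A p (ts i))

  -- a set of identities; a variety is the class of models of one
  record Equations : Set₁ where
    field
      Idx      : Set
      Var      : Idx → Set
      lhs rhs  : (e : Idx) → Term (Var e)

  _⊨_ : Algebra → Equations → Set
  A ⊨ E = ∀ e (ρ : Var e → Carrier A) →
            Algebra._≈_ A (eval A ρ (lhs e)) (eval A ρ (rhs e))
    where open Equations E

  record Hom (A B : Algebra) : Set where
    private
      module A = Algebra A
      module B = Algebra B
    field
      fun  : A.Carrier → B.Carrier
      cong : ∀ {x y} → x A.≈ y → fun x B.≈ fun y
      hom  : ∀ o xs → fun (A.⟦ o ⟧ xs) B.≈ B.⟦ o ⟧ (fun ∘ xs)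

  open Hom public

  _≈Hom_ : ∀ {A B} → Hom A B → Hom A B → Set
  _≈Hom_ {A} {B} f g = ∀ x → Algebra._≈_ B (fun f x) (fun g x)

  _∘Hom_ : ∀ {A B C} → Hom B C → Hom A B → Hom A C
  _∘Hom_ {A} {B} {C} h f = record
    { fun  = fun h ∘ fun f
    ; cong = cong h ∘ cong f
    ; hom  = λ o xs → C.trans (cong h (hom f o xs)) (hom h o (fun f ∘ xs)) }
    where module C = Algebra C

  hom-eval : ∀ {A B} (f : Hom A B) {X : Set} (ρ : X → Algebra.Carrier A) u →
             Algebra._≈_ B (fun f (eval A ρ u)) (eval B (fun f ∘ ρ) u)
  hom-eval {A} {B} f ρ (var x)   = Algebra.refl B
  hom-eval {A} {B} f ρ (op o ts) =
    Algebra.trans B (hom f o _) (Algebra.⟦⟧-cong B o (λ i → hom-eval f ρ (ts i)))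

-- The full setting: signature L_alg, identities E defining the variety
-- K_alg, arity n of R, and terms t₁..t_m, s₁..s_m in x₁..x_n with
-- R(x̄) ⇔ ⋀ᵢ tᵢ(x̄) = sᵢ(x̄).

module Setting (𝑆 : Signature) (E : Algebraic.Equations 𝑆) (n m : ℕ)
               (t s : Fin m → Algebraic.Term 𝑆 (Fin n)) where
  open Signature 𝑆
  open Algebraic 𝑆
  open Equations E

  InKalg : Algebra → Set
  InKalg A = A ⊨ E

  -- {R}-structures (objects of K_R before restricting to the class)
  record RStr : Set₁ where
    field
      setoid : Setoid 0ℓ 0ℓ
    open Setoid setoid public
    field
      R      : (Fin n → Carrier) → Set
      R-resp : ∀ {xs ys} → (∀ j → xs j ≈ ys j) → R xs → R ys

  record RHom (X Y : RStr) : Set where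
    private
      module X = RStr X
      module Y = RStr Y
    field
      rfun  : X.Carrier → Y.Carrier
      rcong : ∀ {x y} → x X.≈ y → rfun x Y.≈ rfun y
      pres  : ∀ xs → X.R xs → Y.R (rfun ∘ xs)

  open RHom public

  _≈RHom_ : ∀ {X Y} → RHom X Y → RHom X Y → Set
  _≈RHom_ {X} {Y} f g = ∀ x → RStr._≈_ Y (rfun f x) (rfun g x)

  _∘R_ : ∀ {X Y Z} → RHom Y Z → RHom X Y → RHom X Z
  g ∘R f = record
    { rfun  = rfun g ∘ rfun f
    ; rcong = rcong g ∘ rcong f
    ; pres  = λ xs p → pres g (rfun f ∘ xs) (pres f xs p) }

  Rdef : (A : Algebra) → (Fin n → Algebra.Carrier A) → Set
  Rdef A xs = ∀ i → Algebra._≈_ A (eval A xs (t i)) (eval A xs (s i))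

  U₀ : Algebra → RStr
  U₀ A = record
    { setoid = Algebra.setoid A
    ; R      = Rdef A
    ; R-resp = λ p q i → A.trans (A.sym (eval-cong A p (t i)))
                          (A.trans (q i) (eval-cong A p (s i))) }
    where module A = Algebra A

  U₁ : ∀ {A B} → Hom A B → RHom (U₀ A) (U₀ B)
  U₁ {A} {B} f = record
    { rfun  = fun f
    ; rcong = cong f
    ; pres  = λ xs p i → B.trans (B.sym (hom-eval f xs (t i)))
                          (B.trans (cong f (p i)) (hom-eval f xs (s i))) }
    where module B = Algebra B

  -- membership in K_R: X is the {R}-reduct of a member of K,
  -- i.e. X = U A for some A ∈ K_alg on the same carrier
  InKR : RStr → Set
  InKR X = Σ (Ops (RStr.setoid X)) λ α →
             let A = record { setoid = RStr.setoid X ; ops = α } in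
             InKalg A × (∀ xs → (RStr.R X xs → Rdef A xs) × (Rdef A xs → RStr.R X xs))

  module _ (X : RStr) where
    private module X = RStr X

    -- δ_X : least congruence on T(X) whose quotient lies in K_alg
    -- (the fully invariant congruence generated by E); the rule var≈
    -- identifies generators equal in the setoid X.
    data _≈δ_ : Term X.Carrier → Term X.Carrier → Set where
      var≈   : ∀ {a b} → a X.≈ b → var a ≈δ var b
      δrefl  : ∀ {u} → u ≈δ u
      δsym   : ∀ {u v} → u ≈δ v → v ≈δ u
      δtrans : ∀ {u v w} → u ≈δ v → v ≈δ w → u ≈δ w
      δcong  : ∀ o {us vs} → (∀ i → us i ≈δ vs i) → op o us ≈δ op o vs
      ax     : ∀ e (σ : Var e → Term X.Carrier) → (lhs e [ σ ]) ≈δ (rhs e [ σ ])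

    -- θ_X : the congruence of F_K(X) = T(X)/δ_X generated by the pairs
    -- ⟨[tᵢ(x̄)], [sᵢ(x̄)]⟩ for x̄ ∈ R^X  (represented on T(X), containing δ_X)
    data _≈θ_ : Term X.Carrier → Term X.Carrier → Set where
      δ⊆θ    : ∀ {u v} → u ≈δ v → u ≈θ v
      gen    : ∀ xs → X.R xs → ∀ i → (t i [ var ∘ xs ]) ≈θ (s i [ var ∘ xs ])
      θrefl  : ∀ {u} → u ≈θ u
      θsym   : ∀ {u v} → u ≈θ v → v ≈θ u
      θtrans : ∀ {u v w} → u ≈θ v → v ≈θ w → u ≈θ w
      θcong  : ∀ o {us vs} → (∀ i → us i ≈θ vs i) → op o us ≈θ op o vs

    FSetoid : Setoid 0ℓ 0ℓ
    FSetoid = record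
      { Carrier = Term X.Carrier
      ; _≈_ = _≈θ_
      ; isEquivalence = record { refl = θrefl ; sym = θsym ; trans = θtrans } }

    F₀ : Algebra
    F₀ = record { setoid = FSetoid ; ops = record { ⟦_⟧ = op ; ⟦⟧-cong = θcong } }

    evalF : ∀ {V : Set} (ρ : V → Term X.Carrier) u → eval F₀ ρ u ≈θ (u [ ρ ])
    evalF ρ (var x)   = θrefl
    evalF ρ (op o ts) = θcong o (λ i → evalF ρ (ts i))

    η : RHom X (U₀ F₀)
    η = record
      { rfun  = var
      ; rcong = λ p → δ⊆θ (var≈ p)
      ; pres  = λ xs p i → θtrans (evalF (var ∘ xs) (t i))
                            (θtrans (gen xs p i) (θsym (evalF (var ∘ xs) (s i)))) }

  module _ {X Y : RStr} (g : RHom X Y) where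
    private
      module X = RStr X
      module Y = RStr Y
    σ : X.Carrier → Term Y.Carrier
    σ = var ∘ rfun g

    assoc : ∀ {V : Set} (τ : V → Term X.Carrier) u →
            _≈δ_ Y ((u [ τ ]) [ σ ]) (u [ (λ v → τ v [ σ ]) ])
    assoc τ (var v)   = δrefl
    assoc τ (op o ts) = δcong o (λ i → assoc τ (ts i))

    mapδ : ∀ {u v} → _≈δ_ X u v → _≈δ_ Y (u [ σ ]) (v [ σ ])
    mapδ (var≈ p)     = var≈ (rcong g p)
    mapδ δrefl        = δrefl
    mapδ (δsym p)     = δsym (mapδ p)
    mapδ (δtrans p q) = δtrans (mapδ p) (mapδ q)
    mapδ (δcong o ps) = δcong o (λ i → mapδ (ps i))
    mapδ (ax e τ)     = δtrans (assoc τ (lhs e))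
                          (δtrans (ax e (λ v → τ v [ σ ])) (δsym (assoc τ (rhs e))))

    mapθ : ∀ {u v} → _≈θ_ X u v → _≈θ_ Y (u [ σ ]) (v [ σ ])
    mapθ (δ⊆θ p)      = δ⊆θ (mapδ p)
    mapθ (gen xs p i) = θtrans (δ⊆θ (assoc (var ∘ xs) (t i)))
                          (θtrans (gen (rfun g ∘ xs) (pres g xs p) i)
                                  (θsym (δ⊆θ (assoc (var ∘ xs) (s i)))))
    mapθ θrefl        = θrefl
    mapθ (θsym p)     = θsym (mapθ p)
    mapθ (θtrans p q) = θtrans (mapθ p) (mapθ q)
    mapθ (θcong o ps) = θcong o (λ i → mapθ (ps i))

    F₁ : Hom (F₀ X) (F₀ Y)
    F₁ = record { fun = _[ σ ] ; cong = mapθ ; hom = λ o xs → θrefl }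

  φ : (X : RStr) (A : Algebra) → Hom (F₀ X) A → RHom X (U₀ A)
  φ X A f = U₁ f ∘R η X

  F-InKalg : ∀ X → InKalg (F₀ X)
  F-InKalg X e ρ = θtrans (evalF X ρ (lhs e))
                     (θtrans (δ⊆θ (ax e ρ)) (θsym (evalF X ρ (rhs e))))

{-# OPTIONS --safe #-}
module Submission where

-- F X is the term algebra over X modulo the least congruence
-- containing all substitution instances of the identities E and the pairs
-- ⟨tᵢ(x̄), sᵢ(x̄)⟩ for x̄ ∈ R^X.  An R-preserving map r : X → U A into a
-- model A of E therefore extends, by evaluating terms under r, to a
-- homomorphism F X → A whose composite with η is r; this gives
-- surjectivity of φ.  Injectivity holds because F X is generated by the
-- variables, and naturality holds on the nose, since both sides send x to
-- h (f [g x]).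

open import Defs
open import Data.Nat using (ℕ)
open import Data.Fin using (Fin)
open import Data.Product using (_×_; _,_)
open import Function using (_∘_)
open import Function.Definitions using (Bijective; Injective; Surjective)

module _ {𝑆 : Signature} where
  open Algebraic 𝑆

  eval-subst : ∀ (A : Algebra) {V W : Set} (ρ : W → Algebra.Carrier A)
               (τ : V → Term W) u →
               Algebra._≈_ A (eval A ρ (u [ τ ])) (eval A (eval A ρ ∘ τ) u)
  eval-subst A ρ τ (var x)   = Algebra.refl A
  eval-subst A ρ τ (op o ts) = Algebra.⟦⟧-cong A o (λ i → eval-subst A ρ τ (ts i))

  ⊨-subst : ∀ {E : Equations} (A : Algebra) → A ⊨ E → ∀ {W : Set}
            (ρ : W → Algebra.Carrier A) e (σ : Equations.Var E e → Term W) →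
            Algebra._≈_ A (eval A ρ (Equations.lhs E e [ σ ]))
                          (eval A ρ (Equations.rhs E e [ σ ]))
  ⊨-subst {E} A A⊨E ρ e σ =
    A.trans (eval-subst A ρ σ (lhs e))
      (A.trans (A⊨E e (eval A ρ ∘ σ)) (A.sym (eval-subst A ρ σ (rhs e))))
    where
    module A = Algebra A
    open Equations E

module FreeAlgebra (𝑆 : Signature) (E : Algebraic.Equations 𝑆) (n m : ℕ)
                   (t s : Fin m → Algebraic.Term 𝑆 (Fin n)) where
  open Algebraic 𝑆
  open Setting 𝑆 E n m t s

  module _ {X : RStr} {A : Algebra} where
    private
      module X = RStr X
      module A = Algebra A

    F-hom-ext : (f g : Hom (F₀ X) A) → (∀ a → fun f (var a) A.≈ fun g (var a)) →
                _≈Hom_ {F₀ X} {A} f g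
    F-hom-ext f g f≈g (var a)   = f≈g a
    F-hom-ext f g f≈g (op o us) =
      A.trans (hom f o us)
        (A.trans (A.⟦⟧-cong o (λ i → F-hom-ext f g f≈g (us i))) (A.sym (hom g o us)))

    φ-injective : Injective (_≈Hom_ {F₀ X} {A}) (_≈RHom_ {X} {U₀ A}) (φ X A)
    φ-injective {f} {g} = F-hom-ext f g

    eval-resp-≈δ : InKalg A → (ρ : X.Carrier → A.Carrier) →
                   (∀ {a b} → a X.≈ b → ρ a A.≈ ρ b) →
                   ∀ {u v} → _≈δ_ X u v → eval A ρ u A.≈ eval A ρ v
    eval-resp-≈δ A⊨E ρ ρ-cong (var≈ a≈b)   = ρ-cong a≈b
    eval-resp-≈δ A⊨E ρ ρ-cong δrefl        = A.refl
    eval-resp-≈δ A⊨E ρ ρ-cong (δsym p)     = A.sym (eval-resp-≈δ A⊨E ρ ρ-cong p)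
    eval-resp-≈δ A⊨E ρ ρ-cong (δtrans p q) =
      A.trans (eval-resp-≈δ A⊨E ρ ρ-cong p) (eval-resp-≈δ A⊨E ρ ρ-cong q)
    eval-resp-≈δ A⊨E ρ ρ-cong (δcong o ps) =
      A.⟦⟧-cong o (λ i → eval-resp-≈δ A⊨E ρ ρ-cong (ps i))
    eval-resp-≈δ A⊨E ρ ρ-cong (ax e σ)     = ⊨-subst {E = E} A A⊨E ρ e σ

    eval-resp-≈θ : InKalg A → (r : RHom X (U₀ A)) →
                   ∀ {u v} → _≈θ_ X u v → eval A (rfun r) u A.≈ eval A (rfun r) v
    eval-resp-≈θ A⊨E r (δ⊆θ p)      = eval-resp-≈δ A⊨E (rfun r) (rcong r) p
    eval-resp-≈θ A⊨E r (gen xs p i) =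
      A.trans (eval-subst A (rfun r) (var ∘ xs) (t i))
        (A.trans (pres r xs p i) (A.sym (eval-subst A (rfun r) (var ∘ xs) (s i))))
    eval-resp-≈θ A⊨E r θrefl        = A.refl
    eval-resp-≈θ A⊨E r (θsym p)     = A.sym (eval-resp-≈θ A⊨E r p)
    eval-resp-≈θ A⊨E r (θtrans p q) =
      A.trans (eval-resp-≈θ A⊨E r p) (eval-resp-≈θ A⊨E r q)
    eval-resp-≈θ A⊨E r (θcong o ps) = A.⟦⟧-cong o (λ i → eval-resp-≈θ A⊨E r (ps i))

    extend : InKalg A → RHom X (U₀ A) → Hom (F₀ X) A
    extend A⊨E r = record
      { fun  = eval A (rfun r)
      ; cong = eval-resp-≈θ A⊨E r
      ; hom  = λ o us → A.refl }

    φ-surjective : InKalg A → Surjective (_≈Hom_ {F₀ X} {A}) (_≈RHom_ {X} {U₀ A}) (φ X A)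
    φ-surjective A⊨E r = extend A⊨E r , λ z≈extend a → z≈extend (var a)

  φ-natural : ∀ {X X' A A'} (g : RHom X' X) (h : Hom A A') (f : Hom (F₀ X) A) →
              _≈RHom_ {X'} {U₀ A'} (φ X' A' (h ∘Hom (f ∘Hom F₁ g))) ((U₁ h ∘R φ X A f) ∘R g)
  φ-natural {A' = A'} g h f x = Algebra.refl A'

theorem3p12 : (𝑆 : Signature) (E : Algebraic.Equations 𝑆) (n m : ℕ)
    (t s : Fin m → Algebraic.Term 𝑆 (Fin n)) →
    let open Algebraic 𝑆 in
    let open Setting 𝑆 E n m t s in
    (∀ (X : RStr) (A : Algebra) → InKR X → InKalg A →
       Bijective (_≈Hom_ {F₀ X} {A}) (_≈RHom_ {X} {U₀ A}) (φ X A))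
    ×
    (∀ (X X' : RStr) (A A' : Algebra) → InKR X → InKR X' → InKalg A → InKalg A' →
       (g : RHom X' X) (h : Hom A A') (f : Hom (F₀ X) A) →
       _≈RHom_ {X'} {U₀ A'} (φ X' A' (h ∘Hom (f ∘Hom F₁ g))) ((U₁ h ∘R φ X A f) ∘R g))
theorem3p12 𝑆 E n m t s =
  (λ X A _ A⊨E → (λ {f} {g} → φ-injective {X} {A} {f} {g}) , φ-surjective A⊨E) ,
  (λ X X' A A' _ _ _ _ → φ-natural)
  where open FreeAlgebra 𝑆 E n m t s
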